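{- For all QCTL formulas $\varphi,\psi$ and any atomic proposition $z$ not occurring in $\varphi$ or $\psi$, \[\mathsf{A}\varphi\mathsf{U}\psi\;\equiv\;\forall z.\Big(\mathsf{AG}\big(z\leftrightarrow(\psi\vee(\varphi\wedge\mathsf{AX}\,z))\big)\to z\Big).\]
   Context: QCTL formulas: $\varphi::= q\mid\neg\varphi\mid\varphi\vee\varphi\mid \mathsf{EX}\varphi\mid \mathsf{E}\varphi\mathsf{U}\varphi\mid\mathsf{A}\varphi\mathsf{U}\varphi\mid\exists p.\varphi$, interpreted at states of finite Kripke structures $\langle V,E,\ell\rangle$ (every vertex has a successor) with the usual CTL semantics over infinite paths and the structure semantics for quantifiers: $\mathcal{K},x\models\exists p.\varphi$ iff there is a Kripke structure with the same vertices and edges whose labelling agrees with $\ell$ on all propositions other than $p$ in which $\varphi$ holds at $x$. $\forall z=\neg\exists z\neg$, $\mathsf{AX}\varphi=\neg\mathsf{EX}\neg\varphi$, $\mathsf{AG}\varphi=\neg\mathsf{E}\top\mathsf{U}\neg\varphi$. Two formulas are equivalent ($\equiv$) if they hold at exactly the same states of every Kripke structure. -}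

module Defs where

open import Data.Nat using (ℕ; zero; suc; _<_)
open import Data.Fin using (Fin)
open import Data.Bool using (Bool; true; false)
open import Data.Product using (Σ; ∃; _×_; _,_)
open import Data.Sum using (_⊎_)
open import Data.Empty using (⊥)
open import Relation.Nullary using (¬_)
open import Relation.Binary.PropositionalEquality using (_≡_; _≢_)
open import Function.Bundles using (_⇔_)

AP : Set
AP = ℕ

data Form : Set where
  prop : AP → Form
  ¬′_  : Form → Form
  _∨′_ : Form → Form → Form
  EX   : Form → Form
  E_U_ : Form → Form → Form
  A_U_ : Form → Form → Form
  ∃′   : AP → Form → Form

Occurs : AP → Form → Set
Occurs z (prop q)  = z ≡ q
Occurs z (¬′ φ)    = Occurs z φ
Occurs z (φ ∨′ ψ)  = Occurs z φ ⊎ Occurs z ψ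
Occurs z (EX φ)    = Occurs z φ
Occurs z (E φ U ψ) = Occurs z φ ⊎ Occurs z ψ
Occurs z (A φ U ψ) = Occurs z φ ⊎ Occurs z ψ
Occurs z (∃′ p φ)  = z ≡ p ⊎ Occurs z φ

_∧′_ : Form → Form → Form
φ ∧′ ψ = ¬′ ((¬′ φ) ∨′ (¬′ ψ))

_⇒′_ : Form → Form → Form
φ ⇒′ ψ = (¬′ φ) ∨′ ψ

_⇔′_ : Form → Form → Form
φ ⇔′ ψ = (φ ⇒′ ψ) ∧′ (ψ ⇒′ φ)

⊤′ : Form
⊤′ = prop 0 ∨′ (¬′ prop 0)

∀′ : AP → Form → Form
∀′ z φ = ¬′ (∃′ z (¬′ φ))

AX : Form → Form
AX φ = ¬′ (EX (¬′ φ))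

AG : Form → Form
AG φ = ¬′ (E ⊤′ U (¬′ φ))

-- The labelling is kept separate (see Lab) since the
-- quantifier ∃p changes it while keeping vertices and edges.
record Kripke : Set where
  field
    n      : ℕ
    E      : Fin n → Fin n → Bool
    serial : (x : Fin n) → ∃ λ y → E x y ≡ true

open Kripke public

Lab : Kripke → Set
Lab K = Fin (n K) → AP → Bool

Path : (K : Kripke) → Fin (n K) → Set
Path K x = Σ (ℕ → Fin (n K)) λ π → (π 0 ≡ x) × ((i : ℕ) → E K (π i) (π (suc i)) ≡ true)

AgreeExcept : (K : Kripke) → AP → Lab K → Lab K → Set
AgreeExcept K p ℓ ℓ′ = (x : Fin (n K)) (q : AP) → q ≢ p → ℓ′ x q ≡ ℓ x q

Sat : (K : Kripke) → Lab K → Fin (n K) → Form → Set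
Sat K ℓ x (prop q)  = ℓ x q ≡ true
Sat K ℓ x (¬′ φ)    = ¬ Sat K ℓ x φ
Sat K ℓ x (φ ∨′ ψ)  = Sat K ℓ x φ ⊎ Sat K ℓ x ψ
Sat K ℓ x (EX φ)    = ∃ λ y → (E K x y ≡ true) × Sat K ℓ y φ
Sat K ℓ x (E φ U ψ) = Σ (Path K x) λ { (π , _) →
  ∃ λ i → Sat K ℓ (π i) ψ × ((j : ℕ) → j < i → Sat K ℓ (π j) φ) }
Sat K ℓ x (A φ U ψ) = (pp : Path K x) → let π = Data.Product.proj₁ pp in
  ∃ λ i → Sat K ℓ (π i) ψ × ((j : ℕ) → j < i → Sat K ℓ (π j) φ)
Sat K ℓ x (∃′ p φ)  = Σ (Lab K) λ ℓ′ → AgreeExcept K p ℓ ℓ′ × Sat K ℓ′ x φ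

_≡F_ : Form → Form → Set
φ ≡F ψ = (K : Kripke) (ℓ : Lab K) (x : Fin (n K)) → Sat K ℓ x φ ⇔ Sat K ℓ x ψ

-- A φ U ψ is the least fixed point of Z ↦ ψ ∨ (φ ∧ AX Z), and the right-hand side says that
-- x lies in every z-labelling that is a fixed point on the states reachable from x.  Every
-- such labelling contains AU: along a path that leaves z whenever it can, the until
-- witness propagates z back to x.  Conversely, labelling z by AU itself is a fixed point.
-- The argument is constructive because satisfaction on a finite structure is decidable:
-- the until operators are least fixed points reached by Kleene iteration within |V|
-- steps, and a quantifier ∃p ranges over the finitely many subsets of states.
module Submission where

open import Defs
open import Level using (0ℓ)
open import Data.Nat using (ℕ; zero; suc; _<_; _≤_; z≤n; s≤s)
open import Data.Nat.Properties using (≤-<-trans; <⇒≱) renaming (_≟_ to _≟ℕ_)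
open import Data.Nat.GeneralisedArithmetic using (fold)
open import Data.Fin using (Fin)
open import Data.Fin.Properties using (any?; all?)
open import Data.Fin.Subset using (Subset; _∈_; _∉_; ∣_∣) renaming (⊥ to ∅)
open import Data.Fin.Subset.Properties using (_∈?_; ∉⊥; ∣p∣≤n; p⊂q⇒∣p∣<∣q∣; anySubset?)
open import Data.Vec using (lookup; tabulate)
open import Data.Vec.Properties using (lookup∘tabulate; []=⇒lookup; lookup⇒[]=)
open import Data.Bool using (Bool; true)
open import Data.Bool.Properties using (_≟_)
open import Data.Product using (Σ; ∃; _×_; _,_; proj₁; proj₂)
import Data.Product as Product
open import Data.Product.Function.NonDependent.Propositional using (_×-⇔_)
open import Data.Sum using (_⊎_; inj₁; inj₂)
import Data.Sum as Sum
open import Data.Sum.Function.Propositional using (_⊎-⇔_)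
open import Function using (_∘_)
open import Function.Bundles using (_⇔_; mk⇔; module Equivalence)
open import Function.Properties.Equivalence using () renaming (sym to ⇔-sym; trans to ⇔-trans)
open import Relation.Nullary using (¬_; Dec; yes; no; does; contradiction)
open import Relation.Nullary.Decidable using (toSum; dec-true; decidable-stable; ¬?; _×-dec_; _⊎-dec_; _→-dec_)
import Relation.Nullary.Decidable as Dec
open import Relation.Unary using (Pred; Decidable; _⊆_)
open import Relation.Binary.PropositionalEquality using (_≡_; refl; sym; trans; subst)

open Equivalence using (to; from)

does≡true⇒ : ∀ {A : Set} (a? : Dec A) → does a? ≡ true → A
does≡true⇒ (yes a) _ = a
does≡true⇒ (no _) ()

toSubset : ∀ {m} {R : Pred (Fin m) 0ℓ} → Decidable R → Subset m
toSubset R? = tabulate (does ∘ R?)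

∈-toSubset : ∀ {m} {R : Pred (Fin m) 0ℓ} (R? : Decidable R) {y} → y ∈ toSubset R? ⇔ R y
∈-toSubset R? {y} = mk⇔
  (λ y∈ → does≡true⇒ (R? y) (trans (sym (lookup∘tabulate (does ∘ R?) y)) ([]=⇒lookup y∈)))
  (λ r → lookup⇒[]= y _ (trans (lookup∘tabulate (does ∘ R?) y) (dec-true (R? y) r)))

⊆-or-∉ : ∀ {m} (p q : Subset m) → (_∈ p) ⊆ (_∈ q) ⊎ ∃ λ x → x ∈ p × x ∉ q
⊆-or-∉ p q with any? (λ x → x ∈? p ×-dec ¬? (x ∈? q))
... | yes escapee = inj₂ escapee
... | no none = inj₁ λ {x} x∈p → decidable-stable (x ∈? q) (λ x∉q → none (x , x∈p , x∉q))

module LeastFixedPoint {m : ℕ} (Φ : Pred (Fin m) 0ℓ → Pred (Fin m) 0ℓ)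
  (Φ-mono : ∀ {Z Z′} → Z ⊆ Z′ → Φ Z ⊆ Φ Z′)
  (Φ? : ∀ {Z} → Decidable Z → Decidable (Φ Z)) where

  step : Subset m → Subset m
  step S = toSubset (Φ? (_∈? S))

  approx : ℕ → Subset m
  approx = fold ∅ step

  ∈-step : ∀ S {y} → y ∈ step S ⇔ Φ (_∈ S) y
  ∈-step S = ∈-toSubset (Φ? (_∈? S))

  approx-⊆-suc : ∀ k → (_∈ approx k) ⊆ (_∈ approx (suc k))
  approx-⊆-suc zero    y∈∅ = contradiction y∈∅ ∉⊥
  approx-⊆-suc (suc k) y∈  =
    from (∈-step (approx (suc k))) (Φ-mono (approx-⊆-suc k) (to (∈-step (approx k)) y∈))

  Stable : ℕ → Set
  Stable k = (_∈ step (approx k)) ⊆ (_∈ approx k)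

  -- Each non-stable stage adds a state, so there are at most m of them.
  stable-or-large : ∀ k → ∃ Stable ⊎ k ≤ ∣ approx k ∣
  stable-or-large zero = inj₂ z≤n
  stable-or-large (suc k) with stable-or-large k | ⊆-or-∉ (step (approx k)) (approx k)
  ... | inj₁ stable | _           = inj₁ stable
  ... | inj₂ _      | inj₁ closed = inj₁ (k , closed)
  ... | inj₂ large  | inj₂ new    = inj₂ (≤-<-trans large (p⊂q⇒∣p∣<∣q∣ (approx-⊆-suc k , new)))

  stabilises : ∃ Stable
  stabilises with stable-or-large (suc m)
  ... | inj₁ stable = stable
  ... | inj₂ large  = contradiction (∣p∣≤n (approx (suc m))) (<⇒≱ large)

  lfp : Subset m
  lfp = approx (proj₁ stabilises)

  lfp-closed : Φ (_∈ lfp) ⊆ (_∈ lfp)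
  lfp-closed Φy = proj₂ stabilises (from (∈-step lfp) Φy)

  approx-least : ∀ {R} → Φ R ⊆ R → ∀ k → (_∈ approx k) ⊆ R
  approx-least R-closed zero    y∈∅ = contradiction y∈∅ ∉⊥
  approx-least R-closed (suc k) y∈  =
    R-closed (Φ-mono (approx-least R-closed k) (to (∈-step (approx k)) y∈))

  lfp-decides : ∀ {R} → Φ R ⊆ R → R ⊆ (_∈ lfp) → Decidable R
  lfp-decides R-closed R⊆lfp y =
    Dec.map′ (approx-least R-closed (proj₁ stabilises)) R⊆lfp (y ∈? lfp)

Until-along : ∀ {A : Set} → Pred A 0ℓ → Pred A 0ℓ → (ℕ → A) → Set
Until-along P Q π = ∃ λ i → Q (π i) × (∀ j → j < i → P (π j))

until-map : ∀ {A : Set} {P P′ Q Q′ : Pred A 0ℓ} {π : ℕ → A} →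
  P ⊆ P′ → Q ⊆ Q′ → Until-along P Q π → Until-along P′ Q′ π
until-map P⊆P′ Q⊆Q′ (i , q , p<i) = i , Q⊆Q′ q , λ j j<i → P⊆P′ (p<i j j<i)

until-ind : ∀ {A : Set} {P Q : Pred A 0ℓ} (R : Pred (ℕ → A) 0ℓ) →
  (∀ {π} → Q (π 0) → R π) → (∀ {π} → P (π 0) → R (π ∘ suc) → R π) →
  ∀ {π} → Until-along P Q π → R π
until-ind {P = P} {Q} R base step (i , q , p<i) = go i q p<i
  where
  go : ∀ i {π} → Q (π i) → (∀ j → j < i → P (π j)) → R π
  go zero    q _   = base q
  go (suc i) q p<i = step (p<i 0 (s≤s z≤n)) (go i q λ j j<i → p<i (suc j) (s≤s j<i))

module Semantics (K : Kripke) where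

  State : Set
  State = Fin (n K)

  _⟶_ : State → State → Set
  y ⟶ y′ = E K y y′ ≡ true

  _⟶?_ : ∀ y y′ → Dec (y ⟶ y′)
  y ⟶? y′ = E K y y′ ≟ true

  Pre∀ Pre∃ : Pred State 0ℓ → Pred State 0ℓ
  Pre∀ Z y = ∀ y′ → y ⟶ y′ → Z y′
  Pre∃ Z y = ∃ λ y′ → y ⟶ y′ × Z y′

  Pre∀? : ∀ {Z} → Decidable Z → Decidable (Pre∀ Z)
  Pre∀? Z? y = all? λ y′ → (y ⟶? y′) →-dec Z? y′

  Pre∃? : ∀ {Z} → Decidable Z → Decidable (Pre∃ Z)
  Pre∃? Z? y = any? λ y′ → (y ⟶? y′) ×-dec Z? y′

  tail : ∀ {y} (pp : Path K y) → Path K (proj₁ pp 1)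
  tail (π , _ , steps) = π ∘ suc , refl , steps ∘ suc

  _◅_ : ∀ {y y′} → y ⟶ y′ → Path K y′ → Path K y
  _◅_ {y} y⟶y′ (π , π0 , steps) =
    (λ { zero → y ; (suc i) → π i }) , refl ,
    λ { zero → subst (y ⟶_) (sym π0) y⟶y′ ; (suc i) → steps i }

  follow : (next : State → State) → (∀ y → y ⟶ next y) → ∀ y → Path K y
  follow next next-⟶ y = fold y next , refl , λ i → next-⟶ (fold y next i)

  serial-path : ∀ y → Path K y
  serial-path = follow (proj₁ ∘ serial K) (proj₂ ∘ serial K)

  escaping-path : ∀ {Z} → Decidable Z → ∀ x →
    Σ (Path K x) λ pp → ∀ j → Z (proj₁ pp (suc j)) → Pre∀ Z (proj₁ pp j)
  escaping-path {Z} Z? x = follow next next-⟶ x , λ j → next-escapes (fold x next j)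
    where
    exit? : Decidable (Pre∃ (¬_ ∘ Z))
    exit? = Pre∃? (¬? ∘ Z?)
    next : State → State
    next y with exit? y
    ... | yes (y′ , _) = y′
    ... | no _         = proj₁ (serial K y)
    next-⟶ : ∀ y → y ⟶ next y
    next-⟶ y with exit? y
    ... | yes (_ , y⟶y′ , _) = y⟶y′
    ... | no _               = proj₂ (serial K y)
    next-escapes : ∀ y → Z (next y) → Pre∀ Z y
    next-escapes y Z-next y′ y⟶y′ with exit? y
    ... | yes (_ , _ , ¬Z) = contradiction Z-next ¬Z
    ... | no no-exit       = decidable-stable (Z? y′) (λ ¬Z → no-exit (y′ , y⟶y′ , ¬Z))

  module Until (P Q : Pred State 0ℓ) where

    AU EU : Pred State 0ℓ
    AU y = (pp : Path K y) → Until-along P Q (proj₁ pp)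
    EU y = Σ (Path K y) (Until-along P Q ∘ proj₁)

    AU-step EU-step : Pred State 0ℓ → Pred State 0ℓ
    AU-step Z y = Q y ⊎ (P y × Pre∀ Z y)
    EU-step Z y = Q y ⊎ (P y × Pre∃ Z y)

    AU-step-mono : ∀ {Z Z′} → Z ⊆ Z′ → AU-step Z ⊆ AU-step Z′
    AU-step-mono Z⊆Z′ = Sum.map₂ (Product.map₂ λ all y′ y⟶y′ → Z⊆Z′ (all y′ y⟶y′))

    EU-step-mono : ∀ {Z Z′} → Z ⊆ Z′ → EU-step Z ⊆ EU-step Z′
    EU-step-mono Z⊆Z′ = Sum.map₂ (Product.map₂ (Product.map₂ (Product.map₂ Z⊆Z′)))

    until-suc : ∀ {π} → P (π 0) → Until-along P Q (π ∘ suc) → Until-along P Q π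
    until-suc p (i , q , p<i) = suc i , q , λ { zero _ → p ; (suc j) (s≤s j<i) → p<i j j<i }

    until-tail : ∀ {π} → ¬ Q (π 0) → Until-along P Q π → P (π 0) × Until-along P Q (π ∘ suc)
    until-tail ¬q (zero , q , _)    = contradiction q ¬q
    until-tail ¬q (suc i , q , p<i) = p<i 0 (s≤s z≤n) , i , q , λ j j<i → p<i (suc j) (s≤s j<i)

    AU-fold : AU-step AU ⊆ AU
    AU-fold (inj₁ q) (π , refl , _) = 0 , q , λ _ ()
    AU-fold (inj₂ (p , all)) pp@(π , refl , steps) = until-suc p (all (π 1) (steps 0) (tail pp))

    AU-unfold : Decidable Q → AU ⊆ AU-step AU
    AU-unfold Q? {y} au with Q? y
    ... | yes q  = inj₁ q
    ... | no ¬q  = inj₂ (proj₁ (until-tail ¬q (au (serial-path y))) ,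
                         λ y′ y⟶y′ pp → proj₂ (until-tail ¬q (au (y⟶y′ ◅ pp))))

    EU-fold : EU-step EU ⊆ EU
    EU-fold {y} (inj₁ q)                        = serial-path y , 0 , q , λ _ ()
    EU-fold (inj₂ (p , y′ , y⟶y′ , pp , until)) = y⟶y′ ◅ pp , until-suc p until

    AU-least : ∀ {Z x} → Decidable Z →
      (∀ (pp : Path K x) j → AU-step Z (proj₁ pp j) → Z (proj₁ pp j)) → AU x → Z x
    AU-least {Z} {x} Z? closed au with escaping-path Z? x
    ... | pp@(π , π0 , _) , escapes = subst Z π0 (reach (au pp) escapes (closed pp))
      where
      Reaches : Pred (ℕ → State) 0ℓ
      Reaches π = (∀ j → Z (π (suc j)) → Pre∀ Z (π j)) →
        (∀ j → AU-step Z (π j) → Z (π j)) → Z (π 0)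
      reach : ∀ {π} → Until-along P Q π → Reaches π
      reach = until-ind {P = P} {Q} Reaches (λ q _ closed → closed 0 (inj₁ q))
        λ p reach-tail escapes closed →
          closed 0 (inj₂ (p , escapes 0 (reach-tail (escapes ∘ suc) (closed ∘ suc))))

    EU-least : ∀ {Z} → EU-step Z ⊆ Z → EU ⊆ Z
    EU-least {Z} closed ((π , π0 , steps) , until) = subst Z π0 (reach until steps)
      where
      Reaches : Pred (ℕ → State) 0ℓ
      Reaches π = (∀ j → π j ⟶ π (suc j)) → Z (π 0)
      reach : ∀ {π} → Until-along P Q π → Reaches π
      reach = until-ind {P = P} {Q} Reaches (λ q _ → closed (inj₁ q))
        λ p reach-tail steps → closed (inj₂ (p , _ , steps 0 , reach-tail (steps ∘ suc)))

    module _ (P? : Decidable P) (Q? : Decidable Q) where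

      AU-step? : ∀ {Z} → Decidable Z → Decidable (AU-step Z)
      AU-step? Z? y = Q? y ⊎-dec (P? y ×-dec Pre∀? Z? y)

      EU-step? : ∀ {Z} → Decidable Z → Decidable (EU-step Z)
      EU-step? Z? y = Q? y ⊎-dec (P? y ×-dec Pre∃? Z? y)

      AU? : Decidable AU
      AU? = lfp-decides AU-fold (AU-least (_∈? lfp) λ _ _ → lfp-closed)
        where open LeastFixedPoint AU-step AU-step-mono AU-step?

      EU? : Decidable EU
      EU? = lfp-decides EU-fold (EU-least lfp-closed)
        where open LeastFixedPoint EU-step EU-step-mono EU-step?

  _≈[_]_ : Lab K → Form → Lab K → Set
  ℓ₁ ≈[ φ ] ℓ₂ = ∀ y q → Occurs q φ → ℓ₁ y q ≡ ℓ₂ y q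

  _[_≔_] : Lab K → AP → (State → Bool) → Lab K
  (ℓ [ p ≔ f ]) y q with q ≟ℕ p
  ... | yes _ = f y
  ... | no _  = ℓ y q

  ≔-at : ∀ ℓ p f y → (ℓ [ p ≔ f ]) y p ≡ f y
  ≔-at ℓ p f y with p ≟ℕ p
  ... | yes _  = refl
  ... | no p≢p = contradiction refl p≢p

  ≔-agrees : ∀ {ℓ p f} → AgreeExcept K p ℓ (ℓ [ p ≔ f ])
  ≔-agrees {p = p} y q q≢p with q ≟ℕ p
  ... | yes q≡p = contradiction q≡p q≢p
  ... | no _    = refl

  ≔-≈ : ∀ {ℓ₁ ℓ₂ ℓ₁′ p φ f} → ℓ₁ ≈[ ∃′ p φ ] ℓ₂ → AgreeExcept K p ℓ₁ ℓ₁′ →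
    (∀ y → ℓ₁′ y p ≡ f y) → ℓ₁′ ≈[ φ ] (ℓ₂ [ p ≔ f ])
  ≔-≈ {p = p} ℓ₁≈ℓ₂ ℓ₁~ℓ₁′ ℓ₁′≡f y q q∈φ with q ≟ℕ p
  ... | yes refl = ℓ₁′≡f y
  ... | no q≢p   = trans (ℓ₁~ℓ₁′ y q q≢p) (ℓ₁≈ℓ₂ y q (inj₂ q∈φ))

  Sat-resp-≈ : ∀ φ {ℓ₁ ℓ₂} → ℓ₁ ≈[ φ ] ℓ₂ → ∀ {x} → Sat K ℓ₁ x φ → Sat K ℓ₂ x φ

  until-resp-≈ : ∀ φ ψ {ℓ₁ ℓ₂} → ℓ₁ ≈[ φ ∨′ ψ ] ℓ₂ → ∀ π →
    Until-along (λ y → Sat K ℓ₁ y φ) (λ y → Sat K ℓ₁ y ψ) π →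
    Until-along (λ y → Sat K ℓ₂ y φ) (λ y → Sat K ℓ₂ y ψ) π
  until-resp-≈ φ ψ {ℓ₁} ℓ₁≈ℓ₂ π =
    until-map {P = λ y → Sat K ℓ₁ y φ} {Q = λ y → Sat K ℓ₁ y ψ}
      (Sat-resp-≈ φ λ y q → ℓ₁≈ℓ₂ y q ∘ inj₁) (Sat-resp-≈ ψ λ y q → ℓ₁≈ℓ₂ y q ∘ inj₂)

  Sat-resp-≈ (prop q)  ℓ₁≈ℓ₂ s = trans (sym (ℓ₁≈ℓ₂ _ q refl)) s
  Sat-resp-≈ (¬′ φ)    ℓ₁≈ℓ₂ ¬s s = ¬s (Sat-resp-≈ φ (λ y q q∈φ → sym (ℓ₁≈ℓ₂ y q q∈φ)) s)
  Sat-resp-≈ (φ ∨′ ψ)  ℓ₁≈ℓ₂ = Sum.map (Sat-resp-≈ φ λ y q → ℓ₁≈ℓ₂ y q ∘ inj₁)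
                                      (Sat-resp-≈ ψ λ y q → ℓ₁≈ℓ₂ y q ∘ inj₂)
  Sat-resp-≈ (EX φ)    ℓ₁≈ℓ₂ (y , x⟶y , s) = y , x⟶y , Sat-resp-≈ φ ℓ₁≈ℓ₂ s
  Sat-resp-≈ (E φ U ψ) ℓ₁≈ℓ₂ (pp , until) = pp , until-resp-≈ φ ψ ℓ₁≈ℓ₂ (proj₁ pp) until
  Sat-resp-≈ (A φ U ψ) ℓ₁≈ℓ₂ au pp = until-resp-≈ φ ψ ℓ₁≈ℓ₂ (proj₁ pp) (au pp)
  Sat-resp-≈ (∃′ p φ) {ℓ₂ = ℓ₂} ℓ₁≈ℓ₂ (ℓ₁′ , ℓ₁~ℓ₁′ , s) =
    ℓ₂ [ p ≔ (λ y → ℓ₁′ y p) ] , ≔-agrees , Sat-resp-≈ φ (≔-≈ {p = p} {φ} ℓ₁≈ℓ₂ ℓ₁~ℓ₁′ λ _ → refl) s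

  Sat-∃ : ∀ {ℓ x p φ} →
    Sat K ℓ x (∃′ p φ) ⇔ ∃ λ (S : Subset (n K)) → Sat K (ℓ [ p ≔ lookup S ]) x φ
  Sat-∃ {ℓ} {p = p} {φ} = mk⇔
    (λ { (ℓ′ , ℓ~ℓ′ , s) → tabulate (λ y → ℓ′ y p) ,
           Sat-resp-≈ φ (≔-≈ {p = p} {φ} (λ _ _ _ → refl) ℓ~ℓ′ λ y → sym (lookup∘tabulate _ y)) s })
    (λ { (S , s) → ℓ [ p ≔ lookup S ] , ≔-agrees , s })

  Sat? : ∀ ℓ x φ → Dec (Sat K ℓ x φ)
  Sat? ℓ x (prop q)  = ℓ x q ≟ true
  Sat? ℓ x (¬′ φ)    = ¬? (Sat? ℓ x φ)
  Sat? ℓ x (φ ∨′ ψ)  = Sat? ℓ x φ ⊎-dec Sat? ℓ x ψ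
  Sat? ℓ x (EX φ)    = Pre∃? (λ y → Sat? ℓ y φ) x
  Sat? ℓ x (E φ U ψ) = Until.EU? _ _ (λ y → Sat? ℓ y φ) (λ y → Sat? ℓ y ψ) x
  Sat? ℓ x (A φ U ψ) = Until.AU? _ _ (λ y → Sat? ℓ y φ) (λ y → Sat? ℓ y ψ) x
  Sat? ℓ x (∃′ p φ)  =
    Dec.map (⇔-sym Sat-∃) (anySubset? λ S → Sat? (ℓ [ p ≔ lookup S ]) x φ)

  Sat-⊤ : ∀ ℓ x → Sat K ℓ x ⊤′
  Sat-⊤ ℓ x = toSum (Sat? ℓ x (prop 0))

  module _ {ℓ : Lab K} {x : State} where

    Sat-∧ : ∀ φ ψ → Sat K ℓ x (φ ∧′ ψ) ⇔ (Sat K ℓ x φ × Sat K ℓ x ψ)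
    Sat-∧ φ ψ = mk⇔
      (λ s → decidable-stable (Sat? ℓ x φ) (s ∘ inj₁) ,
             decidable-stable (Sat? ℓ x ψ) (s ∘ inj₂))
      (λ (a , b) → Sum.[ (λ ¬a → ¬a a) , (λ ¬b → ¬b b) ])

    Sat-⇒ : ∀ φ ψ → Sat K ℓ x (φ ⇒′ ψ) ⇔ (Sat K ℓ x φ → Sat K ℓ x ψ)
    Sat-⇒ φ ψ = mk⇔
      (λ s a → Sum.[ (λ ¬a → contradiction a ¬a) , (λ b → b) ] s)
      (λ f → Sum.[ inj₂ ∘ f , inj₁ ]′ (toSum (Sat? ℓ x φ)))

    Sat-⇔ : ∀ φ ψ → Sat K ℓ x (φ ⇔′ ψ) ⇔ (Sat K ℓ x φ ⇔ Sat K ℓ x ψ)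
    Sat-⇔ φ ψ = mk⇔
      (λ s → let (a , b) = to (Sat-∧ (φ ⇒′ ψ) (ψ ⇒′ φ)) s in
             mk⇔ (to (Sat-⇒ φ ψ) a) (to (Sat-⇒ ψ φ) b))
      (λ e → from (Sat-∧ (φ ⇒′ ψ) (ψ ⇒′ φ)) (from (Sat-⇒ φ ψ) (to e) , from (Sat-⇒ ψ φ) (from e)))

    Sat-AX : ∀ φ → Sat K ℓ x (AX φ) ⇔ Pre∀ (λ y → Sat K ℓ y φ) x
    Sat-AX φ = mk⇔
      (λ s y x⟶y → decidable-stable (Sat? ℓ y φ) λ ¬s → s (y , x⟶y , ¬s))
      (λ all (y , x⟶y , ¬s) → ¬s (all y x⟶y))

    Sat-AG : ∀ φ → Sat K ℓ x (AG φ) ⇔ ((pp : Path K x) (j : ℕ) → Sat K ℓ (proj₁ pp j) φ)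
    Sat-AG φ = mk⇔
      (λ s pp j → decidable-stable (Sat? ℓ _ φ) λ ¬s → s (pp , j , ¬s , λ _ _ → Sat-⊤ ℓ _))
      (λ all (pp , j , ¬s , _) → ¬s (all pp j))

    Sat-∀ : ∀ p φ → Sat K ℓ x (∀′ p φ) ⇔ (∀ ℓ′ → AgreeExcept K p ℓ ℓ′ → Sat K ℓ′ x φ)
    Sat-∀ p φ = mk⇔
      (λ s ℓ′ ℓ~ℓ′ → decidable-stable (Sat? ℓ′ x φ) λ ¬s → s (ℓ′ , ℓ~ℓ′ , ¬s))
      (λ all (ℓ′ , ℓ~ℓ′ , ¬s) → ¬s (all ℓ′ ℓ~ℓ′))

module FixpointCharacterisation (φ ψ : Form) (z : AP) (z∉φ : ¬ Occurs z φ) (z∉ψ : ¬ Occurs z ψ)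
  (K : Kripke) (ℓ : Lab K) where

  open Semantics K
  open Until (λ y → Sat K ℓ y φ) (λ y → Sat K ℓ y ψ)

  body χ : Form
  body = ψ ∨′ (φ ∧′ AX (prop z))
  χ    = prop z ⇔′ body

  Sat-fresh : ∀ {θ ℓ′ y} → ¬ Occurs z θ → AgreeExcept K z ℓ ℓ′ → Sat K ℓ′ y θ ⇔ Sat K ℓ y θ
  Sat-fresh {θ} z∉θ ℓ~ℓ′ = mk⇔ (Sat-resp-≈ θ (λ y q q∈θ → ℓ~ℓ′ y q (z∉ q∈θ)))
                               (Sat-resp-≈ θ (λ y q q∈θ → sym (ℓ~ℓ′ y q (z∉ q∈θ))))
    where
    z∉ : ∀ {q} → Occurs q θ → ¬ q ≡ z
    z∉ q∈θ q≡z = z∉θ (subst (λ r → Occurs r θ) q≡z q∈θ)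

  Sat-body : ∀ {ℓ′ y} → AgreeExcept K z ℓ ℓ′ →
    Sat K ℓ′ y body ⇔ AU-step (λ y′ → ℓ′ y′ z ≡ true) y
  Sat-body {ℓ′} ℓ~ℓ′ = Sat-fresh z∉ψ ℓ~ℓ′ ⊎-⇔
    ⇔-trans (Sat-∧ φ (AX (prop z))) (Sat-fresh z∉φ ℓ~ℓ′ ×-⇔ Sat-AX {ℓ′} (prop z))

  Sat-AG-χ : ∀ {ℓ′ x} → AgreeExcept K z ℓ ℓ′ → Sat K ℓ′ x (AG χ) ⇔
    ((pp : Path K x) (j : ℕ) → ℓ′ (proj₁ pp j) z ≡ true ⇔ AU-step (λ y → ℓ′ y z ≡ true) (proj₁ pp j))
  Sat-AG-χ ℓ~ℓ′ = ⇔-trans (Sat-AG χ) (mk⇔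
    (λ all pp j → ⇔-trans (to (Sat-⇔ (prop z) body) (all pp j)) (Sat-body ℓ~ℓ′))
    (λ all pp j → from (Sat-⇔ (prop z) body) (⇔-trans (all pp j) (⇔-sym (Sat-body ℓ~ℓ′)))))

  AU⇒fixpoint : ∀ {x} → AU x → ∀ ℓ′ → AgreeExcept K z ℓ ℓ′ → Sat K ℓ′ x (AG χ) → ℓ′ x z ≡ true
  AU⇒fixpoint au ℓ′ ℓ~ℓ′ ag =
    AU-least (λ y → ℓ′ y z ≟ true) (λ pp j → from (to (Sat-AG-χ ℓ~ℓ′) ag pp j)) au

  fixpoint⇒AU : ∀ {x} → (∀ ℓ′ → AgreeExcept K z ℓ ℓ′ → Sat K ℓ′ x (AG χ) → ℓ′ x z ≡ true) → AU x
  fixpoint⇒AU {x} fix = to z-is-AU (fix ℓ′ ≔-agrees (from (Sat-AG-χ ≔-agrees) λ _ _ → fixed))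
    where
    au? : Decidable AU
    au? = AU? (λ y → Sat? ℓ y φ) (λ y → Sat? ℓ y ψ)
    ℓ′ : Lab K
    ℓ′ = ℓ [ z ≔ does ∘ au? ]
    z-is-AU : ∀ {y} → ℓ′ y z ≡ true ⇔ AU y
    z-is-AU {y} = mk⇔ (does≡true⇒ (au? y) ∘ trans (sym (≔-at ℓ z _ y)))
                      (trans (≔-at ℓ z _ y) ∘ dec-true (au? y))
    fixed : ∀ {y} → ℓ′ y z ≡ true ⇔ AU-step (λ y′ → ℓ′ y′ z ≡ true) y
    fixed = ⇔-trans z-is-AU (mk⇔ (AU-step-mono (from z-is-AU) ∘ AU-unfold (λ y → Sat? ℓ y ψ))
                                 (AU-fold ∘ AU-step-mono (to z-is-AU)))

  Sat-fixpoint : ∀ {x} → Sat K ℓ x (∀′ z (AG χ ⇒′ prop z)) ⇔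
    (∀ ℓ′ → AgreeExcept K z ℓ ℓ′ → Sat K ℓ′ x (AG χ) → ℓ′ x z ≡ true)
  Sat-fixpoint = ⇔-trans (Sat-∀ z (AG χ ⇒′ prop z))
    (mk⇔ (λ all ℓ′ ℓ~ℓ′ → to (Sat-⇒ (AG χ) (prop z)) (all ℓ′ ℓ~ℓ′))
         (λ all ℓ′ ℓ~ℓ′ → from (Sat-⇒ (AG χ) (prop z)) (all ℓ′ ℓ~ℓ′)))

lemma2 : (φ ψ : Form) (z : AP) → ¬ Occurs z φ → ¬ Occurs z ψ →
    (A φ U ψ) ≡F ∀′ z ((AG (prop z ⇔′ (ψ ∨′ (φ ∧′ AX (prop z))))) ⇒′ prop z)
lemma2 φ ψ z z∉φ z∉ψ K ℓ x = ⇔-trans (mk⇔ AU⇒fixpoint fixpoint⇒AU) (⇔-sym Sat-fixpoint)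
  where open FixpointCharacterisation φ ψ z z∉φ z∉ψ K ℓ
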